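{- Let $i\geq1$ and $n\geq 0$ be integers, and let $\sigma_n=1$ if $n$ is even and $\sigma_n=3$ if $n$ is odd. If $i$ is even, then $q^{[i]}_{3n+1}=r\sigma_n$, $q^{[i]}_{3n+2}=m\overline{\sigma_n}$ and $q^{[i]}_{3n+3}=p\overline{\sigma_n}$ for some antipalindrome $p$ and some palindromes $r,m$. If $i$ is odd, then $q^{[i]}_{3n+1}=r\sigma_n$, $q^{[i]}_{3n+2}=m\sigma_n$ and $q^{[i]}_{3n+3}=p\sigma_n$ for some antipalindrome $m$ and some palindromes $r,p$.
   Context: Alphabet $\mathcal{A}=\{0,1,2,3\}$. The morphism $w\mapsto\overline{w}$ is given by $\overline{0}=0,\overline{1}=3,\overline{2}=2,\overline{3}=1$. A word $w$ is a palindrome if $w^R=w$ and an antipalindrome if $\overline{w}=w^R$, where $w^R$ is the reversal. The words $q^{[i]}_n$: if $i$ is even, $q^{[i]}_0=\varepsilon$, $q^{[i]}_1=1$, $q^{[i]}_2=(13)^{i/2}$, and for $n\ge3$, $q^{[i]}_n=q^{[i]}_{n-1}q^{[i]}_{n-2}$ if $n\equiv1\pmod3$, $q^{[i]}_n=q^{[i]}_{n-1}\overline{q^{[i]}_{n-2}}$ if $n\equiv0,2\pmod3$; if $i$ is odd, $q^{[i]}_0=\varepsilon$, $q^{[i]}_1=1$, $q^{[i]}_2=(13)^{(i-1)/2}1$, and for $n\ge3$, $q^{[i]}_n=q^{[i]}_{n-1}q^{[i]}_{n-2}$ if $n\equiv0\pmod3$, $q^{[i]}_n=q^{[i]}_{n-1}\overline{q^{[i]}_{n-2}}$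 if $n\equiv1,2\pmod3$. -}

module Defs where

open import Data.Nat using (ℕ; zero; suc; _+_; _*_; _%_)
open import Data.Nat.Properties using (_≟_)
open import Data.Bool using (Bool; true; false; if_then_else_)
open import Data.Fin using (Fin; zero; suc)
open import Data.List using (List; []; _∷_; _++_; reverse; map; replicate; concat)
open import Data.Product using (_×_; _,_; proj₁; proj₂)
open import Relation.Binary.PropositionalEquality using (_≡_)
open import Relation.Nullary.Decidable using (⌊_⌋)

Letter : Set
Letter = Fin 4

Word : Set
Word = List Letter

l0 l1 l2 l3 : Letter
l0 = zero
l1 = suc zero
l2 = suc (suc zero)
l3 = suc (suc (suc zero))

barL : Letter → Letter
barL zero = l0
barL (suc zero) = l3
barL (suc (suc zero)) = l2
barL (suc (suc (suc zero))) = l1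

bar : Word → Word
bar = map barL

IsPalindrome : Word → Set
IsPalindrome w = reverse w ≡ w

IsAntipalindrome : Word → Set
IsAntipalindrome w = bar w ≡ reverse w

isEven : ℕ → Bool
isEven zero = true
isEven (suc n) = not' (isEven n)
  where
  not' : Bool → Bool
  not' true = false
  not' false = true

pow13 : ℕ → Word
pow13 k = concat (replicate k (l1 ∷ l3 ∷ []))

q2 : ℕ → Word
q2 i with isEven i
... | true  = pow13 (halfFloor i)
  where
  halfFloor : ℕ → ℕ
  halfFloor zero = zero
  halfFloor (suc zero) = zero
  halfFloor (suc (suc m)) = suc (halfFloor m)
... | false = pow13 (halfFloor i) ++ (l1 ∷ [])
  where
  halfFloor : ℕ → ℕ
  halfFloor zero = zero
  halfFloor (suc zero) = zero
  halfFloor (suc (suc m)) = suc (halfFloor m)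

-- Is the step producing q_n (n ≥ 3) the plain concatenation q_{n-1} q_{n-2}?
-- i even: plain iff n ≡ 1 (mod 3); i odd: plain iff n ≡ 0 (mod 3).
plainStep : ℕ → ℕ → Bool
plainStep i n with isEven i
... | true  = ⌊ n % 3 ≟ 1 ⌋
... | false = ⌊ n % 3 ≟ 0 ⌋

-- qPair i n = (q^{[i]}_n , q^{[i]}_{n+1})
qPair : ℕ → ℕ → Word × Word
qPair i zero = ([] , l1 ∷ [])
qPair i (suc zero) = (l1 ∷ [] , q2 i)
qPair i (suc (suc k)) with qPair i (suc k)
... | (a , b) = (b , (if plainStep i (3 + k) then b ++ a else b ++ bar a))

q : ℕ → ℕ → Word
q i n = proj₁ (qPair i n)

sigma : ℕ → Letter
sigma n = if isEven n then l1 else l3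

module Submission where

-- Write s̄ for the letter conjugate to s.  For even i we show by induction on n
-- that q_{3n+1} = r σ_n and q_{3n+2} = m σ̄_n with r, m palindromes and
-- p = m σ̄_n r̄ an antipalindrome; then q_{3n+3} = q_{3n+2} q̄_{3n+1} = p σ̄_n.
-- For odd i the invariant is q_{3n+1} = r σ_n, q_{3n+2} = m σ_n with r a
-- palindrome, m an antipalindrome and p = m σ_n r a palindrome; q_{3n+3} = p σ_n.

open import Defs
open import Data.Nat using (ℕ; zero; suc; _+_; _*_; _≥_; _%_)
open import Data.Nat.Properties using (_≟_; +-comm; *-comm; *-suc)
open import Data.Nat.DivMod using ([m+kn]%n≡m%n)
open import Data.Bool using (true; false; if_then_else_)
open import Data.Fin using (zero; suc)
open import Data.List using ([]; _∷_; _++_; reverse)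
open import Data.List.Properties using (map-++; reverse-++; reverse-involutive; reverse-map; ++-assoc)
open import Data.Product using (Σ; ∃; _×_; _,_)
open import Relation.Nullary.Decidable using (⌊_⌋)
open import Relation.Binary.PropositionalEquality
open ≡-Reasoning

barL-involutive : ∀ x → barL (barL x) ≡ x
barL-involutive zero = refl
barL-involutive (suc zero) = refl
barL-involutive (suc (suc zero)) = refl
barL-involutive (suc (suc (suc zero))) = refl

bar-involutive : ∀ w → bar (bar w) ≡ w
bar-involutive [] = refl
bar-involutive (x ∷ w) = cong₂ _∷_ (barL-involutive x) (bar-involutive w)

bar-++ : ∀ u v → bar (u ++ v) ≡ bar u ++ bar v
bar-++ = map-++ barL

reverse-bar : ∀ w → reverse (bar w) ≡ bar (reverse w)
reverse-bar w = sym (reverse-map barL w)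

reverse-++-++ : ∀ (u c v : Word) → reverse (u ++ c ++ v) ≡ (reverse v ++ reverse c) ++ reverse u
reverse-++-++ u c v = trans (reverse-++ u (c ++ v)) (cong (_++ reverse u) (reverse-++ c v))

regroup : ∀ u (x : Letter) v (y : Letter) w → (u ++ x ∷ v) ++ y ∷ w ≡ u ++ (x ∷ v ++ y ∷ []) ++ w
regroup u x v y w = trans (++-assoc u (x ∷ v) (y ∷ w)) (cong (λ z → u ++ x ∷ z) (sym (++-assoc v (y ∷ []) w)))

snoc-join : ∀ u (x : Letter) v (y : Letter) → (u ++ x ∷ []) ++ v ++ y ∷ [] ≡ (u ++ x ∷ v) ++ y ∷ []
snoc-join u x v y = trans (++-assoc u (x ∷ []) (v ++ y ∷ [])) (sym (++-assoc u (x ∷ v) (y ∷ [])))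

palindrome-bar : ∀ {w} → IsPalindrome w → IsPalindrome (bar w)
palindrome-bar {w} pal = trans (reverse-bar w) (cong bar pal)

antipalindrome-bar : ∀ {w} → IsAntipalindrome w → IsAntipalindrome (bar w)
antipalindrome-bar {w} anti = begin
  bar (bar w)       ≡⟨ bar-involutive w ⟩
  w                 ≡⟨ sym (bar-involutive w) ⟩
  bar (bar w)       ≡⟨ cong bar anti ⟩
  bar (reverse w)   ≡⟨ sym (reverse-bar w) ⟩
  reverse (bar w)   ∎

palindrome-around : ∀ u {c} → IsPalindrome c → IsPalindrome (u ++ c ++ reverse u)
palindrome-around u {c} pal = begin
  reverse (u ++ c ++ reverse u)                 ≡⟨ reverse-++-++ u c (reverse u) ⟩
  (reverse (reverse u) ++ reverse c) ++ reverse u ≡⟨ cong₂ (λ x y → (x ++ y) ++ reverse u) (reverse-involutive u) pal ⟩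
  (u ++ c) ++ reverse u                         ≡⟨ ++-assoc u c (reverse u) ⟩
  u ++ c ++ reverse u                           ∎

antipalindrome-around : ∀ u {c} → IsAntipalindrome c → IsAntipalindrome (u ++ c ++ bar (reverse u))
antipalindrome-around u {c} anti = begin
  bar (u ++ c ++ bar (reverse u))                     ≡⟨ trans (bar-++ u _) (cong (bar u ++_) (bar-++ c _)) ⟩
  bar u ++ bar c ++ bar (bar (reverse u))             ≡⟨ cong₂ (λ x y → bar u ++ x ++ y) anti (bar-involutive (reverse u)) ⟩
  bar u ++ reverse c ++ reverse u                     ≡⟨ sym (++-assoc (bar u) (reverse c) (reverse u)) ⟩
  (bar u ++ reverse c) ++ reverse u                   ≡⟨ cong (λ x → (x ++ reverse c) ++ reverse u) bar-as-reverse ⟩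
  (reverse (bar (reverse u)) ++ reverse c) ++ reverse u ≡⟨ sym (reverse-++-++ u c (bar (reverse u))) ⟩
  reverse (u ++ c ++ bar (reverse u))                 ∎
  where
  bar-as-reverse : bar u ≡ reverse (bar (reverse u))
  bar-as-reverse = sym (trans (reverse-bar (reverse u)) (cong bar (reverse-involutive u)))

-- The two shapes in which the new (anti)palindromes of the induction arise:
-- (u x v) x w  with  w = u^R  and  (u x v) x̄ w  with  w = ū^R.
palindrome-glue : ∀ u x {v} w → w ≡ reverse u → IsPalindrome v → IsPalindrome ((u ++ x ∷ v) ++ x ∷ w)
palindrome-glue u x {v} .(reverse u) refl pal =
  subst IsPalindrome (sym (regroup u x v x (reverse u))) (palindrome-around u (palindrome-around (x ∷ []) pal))

antipalindrome-glue : ∀ u x {v} w → w ≡ bar (reverse u) → IsAntipalindrome v →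
  IsAntipalindrome ((u ++ x ∷ v) ++ barL x ∷ w)
antipalindrome-glue u x {v} .(bar (reverse u)) refl anti =
  subst IsAntipalindrome (sym (regroup u x v (barL x) (bar (reverse u))))
    (antipalindrome-around u (antipalindrome-around (x ∷ []) anti))

q-plain : ∀ i k → plainStep i (3 + k) ≡ true → q i (3 + k) ≡ q i (2 + k) ++ q i (1 + k)
q-plain i k plain = cong (λ v → if v then q i (2 + k) ++ q i (1 + k) else q i (2 + k) ++ bar (q i (1 + k))) plain

q-twisted : ∀ i k → plainStep i (3 + k) ≡ false → q i (3 + k) ≡ q i (2 + k) ++ bar (q i (1 + k))
q-twisted i k twisted = cong (λ v → if v then q i (2 + k) ++ q i (1 + k) else q i (2 + k) ++ bar (q i (1 + k))) twisted

mod3-shift : ∀ c n → (c + 3 * n) % 3 ≡ c % 3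
mod3-shift c n = trans (cong (λ x → (c + x) % 3) (*-comm 3 n)) ([m+kn]%n≡m%n c n 3)

plainStep-even : ∀ i → isEven i ≡ true → ∀ c n → plainStep i (c + 3 * n) ≡ ⌊ c % 3 ≟ 1 ⌋
plainStep-even i even c n rewrite even | mod3-shift c n = refl

plainStep-odd : ∀ i → isEven i ≡ false → ∀ c n → plainStep i (c + 3 * n) ≡ ⌊ c % 3 ≟ 0 ⌋
plainStep-odd i odd c n rewrite odd | mod3-shift c n = refl

-- (4) The invariants, for a pair (a, b) standing for (q_{3n+1}, q_{3n+2})
-- and the letter s standing for σ_n.

record EvenShape (s : Letter) (a b : Word) : Set where
  constructor evenShape
  field
    r m    : Word
    r-pal  : IsPalindrome r
    m-pal  : IsPalindrome m
    p-anti : IsAntipalindrome (m ++ barL s ∷ bar r)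
    a-eq   : a ≡ r ++ s ∷ []
    b-eq   : b ≡ m ++ barL s ∷ []

record OddShape (s : Letter) (a b : Word) : Set where
  constructor oddShape
  field
    r m    : Word
    r-pal  : IsPalindrome r
    m-anti : IsAntipalindrome m
    p-pal  : IsPalindrome (m ++ s ∷ r)
    a-eq   : a ≡ r ++ s ∷ []
    b-eq   : b ≡ m ++ s ∷ []

evenShape-third : ∀ {s a b} (sh : EvenShape s a b) →
  let open EvenShape sh in b ++ bar a ≡ (m ++ barL s ∷ bar r) ++ barL s ∷ []
evenShape-third {s} (evenShape r m _ _ _ refl refl) =
  trans (cong ((m ++ barL s ∷ []) ++_) (bar-++ r (s ∷ []))) (snoc-join m (barL s) (bar r) (barL s))

oddShape-third : ∀ {s a b} (sh : OddShape s a b) →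
  let open OddShape sh in b ++ a ≡ (m ++ s ∷ r) ++ s ∷ []
oddShape-third {s} (oddShape r m _ _ _ refl refl) = snoc-join m s r s

evenShape-next : ∀ {s a b c d e} → EvenShape s a b →
  c ≡ b ++ bar a → d ≡ c ++ b → e ≡ d ++ bar c → EvenShape (barL s) d e
evenShape-next {s} {c = c} {d} {e} sh@(evenShape r m r-pal m-pal p-anti refl refl) c-eq d-eq e-eq =
  evenShape r′ m′ r′-pal m′-pal p′-anti d-shape e-shape
  where
  t  = barL s
  p  = m ++ t ∷ bar r
  r′ = p ++ t ∷ m
  m′ = r′ ++ t ∷ bar p
  c-shape : c ≡ p ++ t ∷ []
  c-shape = trans c-eq (evenShape-third sh)
  d-shape : d ≡ r′ ++ t ∷ []
  d-shape = trans d-eq (trans (cong (_++ m ++ t ∷ []) c-shape) (snoc-join p t m t))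
  e-shape : e ≡ m′ ++ barL t ∷ []
  e-shape = begin
    e                                        ≡⟨ trans e-eq (cong₂ (λ x y → x ++ bar y) d-shape c-shape) ⟩
    (r′ ++ t ∷ []) ++ bar (p ++ t ∷ [])      ≡⟨ cong ((r′ ++ t ∷ []) ++_) (bar-++ p (t ∷ [])) ⟩
    (r′ ++ t ∷ []) ++ bar p ++ barL t ∷ []   ≡⟨ snoc-join r′ t (bar p) (barL t) ⟩
    m′ ++ barL t ∷ []                        ∎
  r′-pal : IsPalindrome r′
  r′-pal = palindrome-glue m t m (sym m-pal) (palindrome-bar r-pal)
  m′-pal : IsPalindrome m′
  m′-pal = palindrome-glue p t (bar p) p-anti m-pal
  p′-anti : IsAntipalindrome (m′ ++ barL t ∷ bar r′)
  p′-anti = antipalindrome-glue r′ t (bar r′) (cong bar (sym r′-pal)) (antipalindrome-bar p-anti)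

oddShape-next : ∀ {s a b c d e} → OddShape s a b →
  c ≡ b ++ a → d ≡ c ++ bar b → e ≡ d ++ bar c → OddShape (barL s) d e
oddShape-next {s} {c = c} {d} {e} sh@(oddShape r m r-pal m-anti p-pal refl refl) c-eq d-eq e-eq =
  oddShape r′ m′ r′-pal m′-anti p′-pal d-shape e-shape
  where
  t  = barL s
  p  = m ++ s ∷ r
  r′ = p ++ s ∷ bar m
  m′ = r′ ++ t ∷ bar p
  c-shape : c ≡ p ++ s ∷ []
  c-shape = trans c-eq (oddShape-third sh)
  d-shape : d ≡ r′ ++ t ∷ []
  d-shape = begin
    d                                   ≡⟨ trans d-eq (cong (_++ bar (m ++ s ∷ [])) c-shape) ⟩
    (p ++ s ∷ []) ++ bar (m ++ s ∷ [])  ≡⟨ cong ((p ++ s ∷ []) ++_) (bar-++ m (s ∷ [])) ⟩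
    (p ++ s ∷ []) ++ bar m ++ t ∷ []    ≡⟨ snoc-join p s (bar m) t ⟩
    r′ ++ t ∷ []                        ∎
  e-shape : e ≡ m′ ++ t ∷ []
  e-shape = begin
    e                                   ≡⟨ trans e-eq (cong₂ (λ x y → x ++ bar y) d-shape c-shape) ⟩
    (r′ ++ t ∷ []) ++ bar (p ++ s ∷ []) ≡⟨ cong ((r′ ++ t ∷ []) ++_) (bar-++ p (s ∷ [])) ⟩
    (r′ ++ t ∷ []) ++ bar p ++ t ∷ []   ≡⟨ snoc-join r′ t (bar p) t ⟩
    m′ ++ t ∷ []                        ∎
  r′-pal : IsPalindrome r′
  r′-pal = palindrome-glue m s (bar m) m-anti r-pal
  m′-anti : IsAntipalindrome m′
  m′-anti = antipalindrome-glue p s (bar p) (cong bar (sym p-pal)) (antipalindrome-bar m-anti)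
  p′-pal : IsPalindrome (m′ ++ t ∷ r′)
  p′-pal = palindrome-glue r′ t r′ (sym r′-pal) (palindrome-bar p-pal)

-- (13)^k commutes with 13; hence (13)^k is an antipalindrome and (13)^k 1 a palindrome.
pow13-comm : ∀ k → pow13 k ++ l1 ∷ l3 ∷ [] ≡ l1 ∷ l3 ∷ pow13 k
pow13-comm zero = refl
pow13-comm (suc k) = cong (λ w → l1 ∷ l3 ∷ w) (pow13-comm k)

pow13-suc : ∀ k → pow13 (suc k) ≡ (pow13 k ++ l1 ∷ []) ++ l3 ∷ []
pow13-suc k = sym (trans (++-assoc (pow13 k) (l1 ∷ []) (l3 ∷ [])) (pow13-comm k))

pow13-anti : ∀ k → IsAntipalindrome (pow13 k)
pow13-anti zero = refl
pow13-anti (suc k) = begin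
  l3 ∷ l1 ∷ bar (pow13 k)                ≡⟨ cong (λ w → l3 ∷ l1 ∷ w) (pow13-anti k) ⟩
  l3 ∷ l1 ∷ reverse (pow13 k)            ≡⟨ sym (reverse-++ (pow13 k) (l1 ∷ l3 ∷ [])) ⟩
  reverse (pow13 k ++ l1 ∷ l3 ∷ [])      ≡⟨ cong reverse (pow13-comm k) ⟩
  reverse (pow13 (suc k))                ∎

pow13-1-pal : ∀ k → IsPalindrome (pow13 k ++ l1 ∷ [])
pow13-1-pal zero = refl
pow13-1-pal (suc k) = begin
  reverse (l1 ∷ l3 ∷ w)                  ≡⟨ reverse-++ (l1 ∷ l3 ∷ []) w ⟩
  reverse w ++ l3 ∷ l1 ∷ []              ≡⟨ cong (_++ l3 ∷ l1 ∷ []) (pow13-1-pal k) ⟩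
  w ++ l3 ∷ l1 ∷ []                      ≡⟨ ++-assoc (pow13 k) (l1 ∷ []) (l3 ∷ l1 ∷ []) ⟩
  pow13 k ++ l1 ∷ l3 ∷ l1 ∷ []           ≡⟨ sym (++-assoc (pow13 k) (l1 ∷ l3 ∷ []) (l1 ∷ [])) ⟩
  (pow13 k ++ l1 ∷ l3 ∷ []) ++ l1 ∷ []   ≡⟨ cong (_++ l1 ∷ []) (pow13-comm k) ⟩
  l1 ∷ l3 ∷ w                            ∎
  where
  w = pow13 k ++ l1 ∷ []

isEven-suc-suc : ∀ j → isEven (2 + j) ≡ isEven j
isEven-suc-suc j with isEven j
... | true  = refl
... | false = refl

q2-suc-suc : ∀ j → q2 (2 + j) ≡ l1 ∷ l3 ∷ q2 j
q2-suc-suc j with isEven j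
... | true  = refl
... | false = refl

q2-even : ∀ j → isEven j ≡ true → ∃ λ k → q2 (2 + j) ≡ pow13 (suc k)
q2-even zero _ = 0 , refl
q2-even (suc (suc j)) even with q2-even j (trans (sym (isEven-suc-suc j)) even)
... | k , eq = suc k , trans (q2-suc-suc (2 + j)) (cong (λ w → l1 ∷ l3 ∷ w) eq)

q2-odd : ∀ i → isEven i ≡ false → ∃ λ k → q2 i ≡ pow13 k ++ l1 ∷ []
q2-odd (suc zero) _ = 0 , refl
q2-odd (suc (suc j)) odd with q2-odd j (trans (sym (isEven-suc-suc j)) odd)
... | k , eq = suc k , trans (q2-suc-suc j) (cong (λ w → l1 ∷ l3 ∷ w) eq)

sigma-suc : ∀ n → sigma (suc n) ≡ barL (sigma n)
sigma-suc n with isEven n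
... | true  = refl
... | false = refl

evenShapes : ∀ i → isEven i ≡ true → i ≥ 1 → ∀ n → EvenShape (sigma n) (q i (1 + 3 * n)) (q i (2 + 3 * n))
evenShapes (suc (suc j)) even _ zero with q2-even j (trans (sym (isEven-suc-suc j)) even)
... | k , eq = evenShape [] (pow13 k ++ l1 ∷ []) refl (pow13-1-pal k)
                 (subst IsAntipalindrome (pow13-suc k) (pow13-anti (suc k))) refl (trans eq (pow13-suc k))
evenShapes i even i≥1 (suc n) =
  subst₂ (λ s k → EvenShape s (q i (1 + k)) (q i (2 + k))) (sym (sigma-suc n)) (sym (*-suc 3 n))
    (evenShape-next (evenShapes i even i≥1 n)
      (q-twisted i (3 * n) (plainStep-even i even 3 n))
      (q-plain i (1 + 3 * n) (plainStep-even i even 4 n))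
      (q-twisted i (2 + 3 * n) (plainStep-even i even 5 n)))

oddShapes : ∀ i → isEven i ≡ false → ∀ n → OddShape (sigma n) (q i (1 + 3 * n)) (q i (2 + 3 * n))
oddShapes i odd zero with q2-odd i odd
... | k , eq = oddShape [] (pow13 k) refl (pow13-anti k) (pow13-1-pal k) refl eq
oddShapes i odd (suc n) =
  subst₂ (λ s k → OddShape s (q i (1 + k)) (q i (2 + k))) (sym (sigma-suc n)) (sym (*-suc 3 n))
    (oddShape-next (oddShapes i odd n)
      (q-plain i (3 * n) (plainStep-odd i odd 3 n))
      (q-twisted i (1 + 3 * n) (plainStep-odd i odd 4 n))
      (q-twisted i (2 + 3 * n) (plainStep-odd i odd 5 n)))

even-factorisation : ∀ {s a b c} → EvenShape s a b → c ≡ b ++ bar a →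
  Σ Word (λ r → Σ Word (λ m → Σ Word (λ p →
    IsAntipalindrome p × IsPalindrome r × IsPalindrome m
    × a ≡ r ++ (s ∷ []) × b ≡ m ++ (barL s ∷ []) × c ≡ p ++ (barL s ∷ []))))
even-factorisation sh@(evenShape r m r-pal m-pal p-anti a-eq b-eq) c-eq =
  r , m , _ , p-anti , r-pal , m-pal , a-eq , b-eq , trans c-eq (evenShape-third sh)

odd-factorisation : ∀ {s a b c} → OddShape s a b → c ≡ b ++ a →
  Σ Word (λ r → Σ Word (λ m → Σ Word (λ p →
    IsAntipalindrome m × IsPalindrome r × IsPalindrome p
    × a ≡ r ++ (s ∷ []) × b ≡ m ++ (s ∷ []) × c ≡ p ++ (s ∷ []))))
odd-factorisation sh@(oddShape r m r-pal m-anti p-pal a-eq b-eq) c-eq =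
  r , m , _ , m-anti , r-pal , p-pal , a-eq , b-eq , trans c-eq (oddShape-third sh)

proposition8 : (i n : ℕ) → i ≥ 1 →
    (isEven i ≡ true →
      Σ Word (λ r → Σ Word (λ m → Σ Word (λ p →
        IsAntipalindrome p × IsPalindrome r × IsPalindrome m
        × q i (3 * n + 1) ≡ r ++ (sigma n ∷ [])
        × q i (3 * n + 2) ≡ m ++ (barL (sigma n) ∷ [])
        × q i (3 * n + 3) ≡ p ++ (barL (sigma n) ∷ [])))))
    × (isEven i ≡ false →
      Σ Word (λ r → Σ Word (λ m → Σ Word (λ p →
        IsAntipalindrome m × IsPalindrome r × IsPalindrome p
        × q i (3 * n + 1) ≡ r ++ (sigma n ∷ [])
        × q i (3 * n + 2) ≡ m ++ (sigma n ∷ [])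
        × q i (3 * n + 3) ≡ p ++ (sigma n ∷ [])))))
proposition8 i n i≥1 rewrite +-comm (3 * n) 1 | +-comm (3 * n) 2 | +-comm (3 * n) 3 =
  (λ even → even-factorisation (evenShapes i even i≥1 n) (q-twisted i (3 * n) (plainStep-even i even 3 n))) ,
  (λ odd → odd-factorisation (oddShapes i odd n) (q-plain i (3 * n) (plainStep-odd i odd 3 n)))
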